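{- Let $I=(x_1,\ldots,x_n)$ be any list of items with all sizes in $(1/3,1]$. Let $I'=(x'_1,\ldots,x'_n)$ with sizes in $(0,1]$ satisfy $x'_i>x_i$ for a single index $i\in\{1,\ldots,n\}$ and $x'_j=x_j$ for all $j\ne i$. Then $\mathrm{BF}(I)\le\mathrm{BF}(I')$.
   Context: Bin packing: a list of items with sizes in $(0,1]$ must be assigned to unit-capacity bins so that each bin's total size is at most $1$. Best Fit ($\mathrm{BF}$) is the online algorithm that processes items in list order and packs the current item into the fullest already-open bin in which it fits, opening a new bin if it fits in none; $\mathrm{BF}(I)$ denotes the number of bins it uses on list $I$.
   Formalization: The item sizes of both lists I and I′ are rational numbers. -}

module Defs where

open import Data.Nat using (ℕ)
open import Data.Rational using (ℚ; 0ℚ; 1ℚ; _+_; _≤_; _<_; _≤ᵇ_; _/_)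
open import Data.List using (List; []; _∷_; length)
open import Data.Bool using (Bool; true; false; if_then_else_)
open import Data.Maybe using (Maybe; just; nothing)
open import Data.Product using (_×_; _,_)
open import Data.Fin using (Fin)
open import Data.Vec using (Vec; lookup)

-- A bin configuration is the list of current loads of the open bins
-- (in opening order).

fullestFitting : ℚ → List ℚ → Maybe ℚ
fullestFitting x [] = nothing
fullestFitting x (ℓ ∷ bs) with fullestFitting x bs | (ℓ + x) ≤ᵇ 1ℚ
... | r        | false = r
... | nothing  | true  = just ℓ
... | just m   | true  = if m ≤ᵇ ℓ then just ℓ else just m

-- Put x into the first bin whose load equals `target` (the fullest one
-- in which x fits; ties broken by earliest bin -- the number of bins
-- does not depend on the tie-break).
putInto : ℚ → ℚ → List ℚ → List ℚ
putInto x t [] = []   -- unreachable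
putInto x t (ℓ ∷ bs) with (ℓ ≤ᵇ t) Data.Bool.∧ (t ≤ᵇ ℓ)
... | true  = (ℓ + x) ∷ bs
... | false = ℓ ∷ putInto x t bs

bfStep : List ℚ → ℚ → List ℚ
bfStep bins x with fullestFitting x bins
... | just t  = putInto x t bins
... | nothing = bins Data.List.++ (x ∷ [])

bfBins : List ℚ → List ℚ
bfBins = Data.List.foldl bfStep []

BF : List ℚ → ℕ
BF I = length (bfBins I)

toList : {n : ℕ} → (Fin n → ℚ) → List ℚ
toList f = Data.List.tabulate f

oneThird : ℚ
oneThird = Data.Integer.+ 1 / 3
  where import Data.Integer

{-# OPTIONS --safe #-}

-- Every item is larger than 1/3, so a bin holds at most two items, no item
-- fits into a bin holding two, and no two single-item bins fit together.
-- Best Fit therefore acts only on the multiset O of single-item bins: an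
-- item joins the largest member of O it fits with, or is added to O.  Run
-- Best Fit on I and I′ side by side and let k, k′ count the two-item bins.
-- From the modified item on, the two states stay in one of three relations
-- (an item common to both lists preserves the disjunction):
--   O = O′ and k ≤ k′;
--   O, O′ differ in one element, the one in O being smaller, and k ≤ k′;
--   O′ is O plus two elements and k ≤ k′ + 1.
-- Each gives BF(I) = k + |O| ≤ k′ + |O′| = BF(I′).

module Submission where

open import Defs
import Data.Nat
open import Data.Nat as ℕ using (ℕ; suc; s≤s)
import Data.Nat.Properties as ℕ
open import Data.Fin using (Fin; zero; suc)
import Data.Fin.Properties as Fin
open import Data.Rational using (ℚ; 0ℚ; 1ℚ; _≤_; _<_; _+_; _≤ᵇ_)
import Data.Rational.Properties as ℚ
open import Data.Bool using (true; false; T; _∧_)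
open import Data.Bool.Properties using (T-∧)
open import Data.Maybe using (Maybe; just; nothing)
open import Data.Product using (_×_; _,_; ∃; ∃₂; Σ; proj₁; proj₂)
open import Data.Sum using (_⊎_; inj₁; inj₂)
open import Data.Empty using (⊥-elim)
open import Relation.Nullary using (¬_)
open import Relation.Binary.Definitions using (Symmetric)
open import Relation.Binary.PropositionalEquality
  using (_≡_; _≢_; refl; sym; cong; cong₂; subst; resp₂)
open import Function using (_∘_; Equivalence)
open import Data.List using (List; []; _∷_; _++_; [_]; length; foldl; tabulate)
import Data.List.Properties as List
open import Data.List.Relation.Unary.All as All using (All; []; _∷_)
import Data.List.Relation.Unary.All.Properties as All
open import Data.List.Relation.Unary.AllPairs as AllPairs using (AllPairs; []; _∷_)
open import Data.List.Relation.Unary.Any using (here; there)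
open import Data.List.Membership.Propositional using (_∈_)
open import Data.List.Membership.Propositional.Properties using (∈-++⁻; ∈-∃++)
open import Data.List.Relation.Binary.Permutation.Propositional
open import Data.List.Relation.Binary.Permutation.Propositional.Properties
import Data.List.Relation.Binary.Permutation.Setoid.Properties as Setoid↭
import Relation.Binary.PropositionalEquality as ≡

private
  variable
    a b t t′ u v y y′ : ℚ
    B B′ B₀ O O′ O₀ T₀ xs ys : List ℚ
    k k′ : ℕ

module _ {A : Set} where

  ↭-∷-under : ∀ {x z : A} {xs ys} → xs ↭ x ∷ ys → z ∷ xs ↭ x ∷ z ∷ ys
  ↭-∷-under {x = x} {z} p = ↭-trans (prep z p) (swap z x ↭-refl)

  ↭-head-∈ : ∀ {x : A} {xs ys} → xs ↭ x ∷ ys → x ∈ xs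
  ↭-head-∈ p = ∈-resp-↭ (↭-sym p) (here refl)

  ↭-tail-⊆ : ∀ {x z : A} {xs ys} → xs ↭ x ∷ ys → z ∈ ys → z ∈ xs
  ↭-tail-⊆ p z∈ys = ∈-resp-↭ (↭-sym p) (there z∈ys)

  ∈⇒↭-∷ : ∀ {x : A} {xs} → x ∈ xs → ∃ λ ys → xs ↭ x ∷ ys
  ∈⇒↭-∷ {x = x} x∈xs with ws , zs , refl ← ∈-∃++ x∈xs = ws ++ zs , shift x ws zs

  ∷-↭-∷-inv : ∀ {u t : A} {us ts : List A} → u ∷ us ↭ t ∷ ts →
    (t ≡ u × us ↭ ts) ⊎ (∃ λ rs → us ↭ t ∷ rs × ts ↭ u ∷ rs)
  ∷-↭-∷-inv p with ∈-resp-↭ (↭-sym p) (here refl)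
  ... | here refl = inj₁ (refl , drop-∷ p)
  ... | there t∈us with rs , q ← ∈⇒↭-∷ t∈us =
    inj₂ (rs , q , drop-∷ (↭-trans (↭-sym p) (↭-∷-under q)))

  ∷-∷-↭-∷-inv : ∀ {a b t : A} {xs ts : List A} → a ∷ b ∷ xs ↭ t ∷ ts →
    (t ≡ a × ts ↭ b ∷ xs) ⊎ (t ≡ b × ts ↭ a ∷ xs) ⊎ (∃ λ rs → xs ↭ t ∷ rs × ts ↭ a ∷ b ∷ rs)
  ∷-∷-↭-∷-inv {a = a} p with ∷-↭-∷-inv p
  ... | inj₁ (refl , q) = inj₁ (refl , ↭-sym q)
  ... | inj₂ (rs , q , ts↭) with ∷-↭-∷-inv q
  ...   | inj₁ (refl , xs↭rs) = inj₂ (inj₁ (refl , ↭-trans ts↭ (prep a (↭-sym xs↭rs))))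
  ...   | inj₂ (rs′ , xs↭ , rs↭) = inj₂ (inj₂ (rs′ , xs↭ , ↭-trans ts↭ (prep a rs↭)))

≤ᵇ-true : ∀ {p q} → (p ≤ᵇ q) ≡ true → p ≤ q
≤ᵇ-true eq = ℚ.≤ᵇ⇒≤ (subst T (sym eq) _)

≤ᵇ-false : ∀ {p q} → (p ≤ᵇ q) ≡ false → ¬ p ≤ q
≤ᵇ-false eq p≤q = subst T eq (ℚ.≤⇒≤ᵇ p≤q)

≤ᵇ∧≥ᵇ-true : ∀ {p q} → ((p ≤ᵇ q) ∧ (q ≤ᵇ p)) ≡ true → p ≡ q
≤ᵇ∧≥ᵇ-true eq with p≤q , q≤p ← Equivalence.to T-∧ (subst T (sym eq) _) =
  ℚ.≤-antisym (ℚ.≤ᵇ⇒≤ p≤q) (ℚ.≤ᵇ⇒≤ q≤p)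

≤ᵇ∧≥ᵇ-false : ∀ {p q} → ((p ≤ᵇ q) ∧ (q ≤ᵇ p)) ≡ false → p ≢ q
≤ᵇ∧≥ᵇ-false {p} eq refl =
  subst T eq (Equivalence.from T-∧ (ℚ.≤⇒≤ᵇ (ℚ.≤-refl {p}) , ℚ.≤⇒≤ᵇ (ℚ.≤-refl {p})))

Fits : ℚ → ℚ → Set
Fits ℓ y = ℓ + y ≤ 1ℚ

Incompatible : ℚ → ℚ → Set
Incompatible a b = ¬ Fits a b

Large : ℚ → Set
Large y = oneThird < y

Closed : ℚ → Set
Closed ℓ = ∀ {y} → Large y → ¬ Fits ℓ y

Incompatible-sym : Symmetric Incompatible
Incompatible-sym {a} {b} ¬fits fits = ¬fits (subst (_≤ 1ℚ) (ℚ.+-comm b a) fits)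

AllPairs-Incompatible-resp-↭ : O ↭ O′ → AllPairs Incompatible O → AllPairs Incompatible O′
AllPairs-Incompatible-resp-↭ p =
  Setoid↭.AllPairs-resp-↭ (≡.setoid ℚ) (λ {a} {b} → Incompatible-sym {a} {b})
    (resp₂ Incompatible) (↭⇒↭ₛ p)

Fits-antimonoˡ : u ≤ v → Fits v y → Fits u y
Fits-antimonoˡ {y = y} u≤v = ℚ.≤-trans (ℚ.+-monoˡ-≤ y u≤v)

Fits-antimonoʳ : y ≤ y′ → Fits t y′ → Fits t y
Fits-antimonoʳ {t = t} y≤y′ = ℚ.≤-trans (ℚ.+-monoʳ-≤ t y≤y′)

Incompatible⇒≤ : Incompatible a b → Fits a y → y ≤ b
Incompatible⇒≤ {a} {b} {y} ¬fits fits with ℚ.≤-total y b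
... | inj₁ y≤b = y≤b
... | inj₂ b≤y = ⊥-elim (¬fits (Fits-antimonoʳ {t = a} b≤y fits))

Large+Large-closed : Large t → Large u → Closed (t + u)
-- 1/3 + 1/3 + 1/3 normalises to 1ℚ, so refl closes the cycle 1 < t + u + y ≤ 1.
Large+Large-closed lt lu ly fits =
  ℚ.<-irrefl refl (ℚ.<-≤-trans (ℚ.+-mono-< (ℚ.+-mono-< lt lu) ly) fits)

Fullest : ℚ → ℚ → List ℚ → Set
Fullest y t B = All (λ ℓ → Fits ℓ y → ℓ ≤ t) B

FullestFitting : ℚ → List ℚ → Maybe ℚ → Set
FullestFitting y B nothing  = All (λ ℓ → ¬ Fits ℓ y) B
FullestFitting y B (just t) = t ∈ B × Fits t y × Fullest y t B

fullestFitting-correct : ∀ y B → FullestFitting y B (fullestFitting y B)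
fullestFitting-correct y [] = []
fullestFitting-correct y (ℓ ∷ B)
  with fullestFitting y B | fullestFitting-correct y B | (ℓ + y) ≤ᵇ 1ℚ in fits?
... | nothing | none | false = ≤ᵇ-false fits? ∷ none
... | just m | m∈B , fits , fullest | false =
  there m∈B , fits , (⊥-elim ∘ ≤ᵇ-false fits?) ∷ fullest
... | nothing | none | true =
  here refl , ≤ᵇ-true fits? , (λ _ → ℚ.≤-refl) ∷ All.map (λ ¬fits → ⊥-elim ∘ ¬fits) none
... | just m | m∈B , fits , fullest | true with m ≤ᵇ ℓ in m≤ℓ?
...   | true = here refl , ≤ᵇ-true fits? , (λ _ → ℚ.≤-refl) ∷
                 All.map (λ ≤m fits → ℚ.≤-trans (≤m fits) (≤ᵇ-true m≤ℓ?)) fullest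
...   | false = there m∈B , fits , (λ _ → ℚ.<⇒≤ (ℚ.≰⇒> (≤ᵇ-false m≤ℓ?))) ∷ fullest

putInto-↭ : ∀ y B → t ∈ B → ∃ λ B₀ → B ↭ t ∷ B₀ × putInto y t B ↭ (t + y) ∷ B₀
putInto-↭ {t} y (ℓ ∷ B) t∈ with (ℓ ≤ᵇ t) ∧ (t ≤ᵇ ℓ) in ℓ≡t?
... | true with refl ← ≤ᵇ∧≥ᵇ-true {ℓ} {t} ℓ≡t? = B , ↭-refl , ↭-refl
... | false with t∈
...   | here t≡ℓ = ⊥-elim (≤ᵇ∧≥ᵇ-false {ℓ} ℓ≡t? (sym t≡ℓ))
...   | there t∈B with B₀ , B↭ , put↭ ← putInto-↭ y B t∈B =
  ℓ ∷ B₀ , ↭-∷-under B↭ , ↭-∷-under put↭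

data Placement (O : List ℚ) (y : ℚ) : Set where
  opens : All (λ ℓ → ¬ Fits ℓ y) O → Placement O y
  joins : (t : ℚ) (O₀ : List ℚ) → O ↭ t ∷ O₀ → Fits t y → Fullest y t O → Placement O y

singlesAfter : Placement O y → List ℚ
singlesAfter {O} {y} (opens _) = y ∷ O
singlesAfter (joins _ O₀ _ _ _) = O₀

closedAfter : ℕ → Placement O y → ℕ
closedAfter k (opens _) = k
closedAfter k (joins _ _ _ _ _) = suc k

record Decomposition (B : List ℚ) (k : ℕ) (O : List ℚ) : Set where
  constructor decomposition
  field
    closedBins   : List ℚ
    count        : length closedBins ≡ k
    split        : B ↭ closedBins ++ O
    closed       : All Closed closedBins
    large        : All Large O
    incompatible : AllPairs Incompatible O
open Decomposition

decomposition-[] : Decomposition [] 0 []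
decomposition-[] = decomposition [] refl ↭-refl [] [] []

decomposition-length : Decomposition B k O → length B ≡ k ℕ.+ length O
decomposition-length (decomposition C refl split _ _ _) =
  ≡.trans (↭-length split) (List.length-++ C)

All-singles : ∀ {P : ℚ → Set} → Decomposition B k O → All P B → All P O
All-singles d = All.++⁻ʳ (closedBins d) ∘ All-resp-↭ (split d)

decomposition-opens : Decomposition B k O → Large y → All (λ ℓ → ¬ Fits ℓ y) O →
  Decomposition (B ++ [ y ]) k (y ∷ O)
decomposition-opens {B} {y = y} (decomposition C count split closed large incompatible) ly none =
  decomposition C count
    (↭-trans (↭-sym (∷↭∷ʳ y B)) (↭-trans (prep y split) (↭-sym (shift y C _))))
    closed (ly ∷ large) (All.map (λ {ℓ} → Incompatible-sym {ℓ} {y}) none ∷ incompatible)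

decomposition-joins : Decomposition B k O → Large y → B ↭ t ∷ B₀ → O ↭ t ∷ O₀ →
  putInto y t B ↭ (t + y) ∷ B₀ → Decomposition (putInto y t B) (suc k) O₀
decomposition-joins {B = B} {O = O} {t = t} {B₀ = B₀} {O₀ = O₀}
  (decomposition C count split closed large incompatible) ly B↭ O↭ put↭
  with lt ∷ large₀ ← All-resp-↭ O↭ large =
  decomposition ((t + _) ∷ C) (cong suc count) (↭-trans put↭ (prep _ B₀↭C++O₀))
    (Large+Large-closed lt ly ∷ closed) large₀
    (AllPairs.tail (AllPairs-Incompatible-resp-↭ O↭ incompatible))
  where
    open PermutationReasoning
    B₀↭C++O₀ : B₀ ↭ C ++ O₀
    B₀↭C++O₀ = drop-∷ (begin
      t ∷ B₀      ↭⟨ ↭-sym B↭ ⟩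
      B           ↭⟨ split ⟩
      C ++ O      ↭⟨ ++⁺ˡ C O↭ ⟩
      C ++ t ∷ O₀ ↭⟨ shift t C O₀ ⟩
      t ∷ C ++ O₀ ∎)

bfStep-decomposition : Decomposition B k O → Large y →
  Σ (Placement O y) λ s → Decomposition (bfStep B y) (closedAfter k s) (singlesAfter s)
bfStep-decomposition {B} {y = y} d ly
  with fullestFitting y B | fullestFitting-correct y B
... | nothing | none = opens (All-singles d none) , decomposition-opens d ly (All-singles d none)
... | just t | t∈B , fits , fullest with ∈-++⁻ (closedBins d) (∈-resp-↭ (split d) t∈B)
...   | inj₁ t∈C = ⊥-elim (All.lookup (closed d) t∈C ly fits)
...   | inj₂ t∈O
  with O₀ , O↭ ← ∈⇒↭-∷ t∈O | B₀ , B↭ , put↭ ← putInto-↭ y B t∈B =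
  joins t O₀ O↭ fits (All-singles d fullest) , decomposition-joins d ly B↭ O↭ put↭

data Coupled (O O′ : List ℚ) (k k′ : ℕ) : Set where
  same     : O ↭ O′ → k ℕ.≤ k′ → Coupled O O′ k k′
  replaced : ∀ {u v T} → u ≤ v → O ↭ u ∷ T → O′ ↭ v ∷ T → k ℕ.≤ k′ → Coupled O O′ k k′
  extra    : ∀ {a b} → O′ ↭ a ∷ b ∷ O → k ℕ.≤ suc k′ → Coupled O O′ k k′

coupled-length : Coupled O O′ k k′ → k ℕ.+ length O ℕ.≤ k′ ℕ.+ length O′
coupled-length (same p k≤k′) rewrite ↭-length p = ℕ.+-monoˡ-≤ _ k≤k′
coupled-length (replaced _ pu pv k≤k′) rewrite ↭-length pu | ↭-length pv =
  ℕ.+-monoˡ-≤ _ k≤k′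
coupled-length {O} {k′ = k′} (extra p k≤1+k′)
  rewrite ↭-length p | ℕ.+-suc k′ (suc (length O)) | ℕ.+-suc k′ (length O) =
  ℕ.m≤n⇒m≤1+n (ℕ.+-monoˡ-≤ (length O) k≤1+k′)

CoupledAfter : (O O′ : List ℚ) (k k′ : ℕ) (y : ℚ) → Set
CoupledAfter O O′ k k′ y = (s : Placement O y) (s′ : Placement O′ y) →
  Coupled (singlesAfter s) (singlesAfter s′) (closedAfter k s) (closedAfter k′ s′)

fullest-antisym : t ∈ O′ → Fits t y → Fullest y t′ O′ → t′ ∈ O → Fits t′ y → Fullest y t O → t ≡ t′
fullest-antisym t∈O′ fits fullest′ t′∈O fits′ fullest =
  ℚ.≤-antisym (All.lookup fullest′ t∈O′ fits) (All.lookup fullest t′∈O fits′)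

same-step : O ↭ O′ → k ℕ.≤ k′ → CoupledAfter O O′ k k′ y
same-step p k≤k′ (opens _) (opens _) = same (prep _ p) k≤k′
same-step p _ (opens none) (joins _ _ q′ fits′ _) =
  ⊥-elim (All.lookup none (∈-resp-↭ (↭-sym p) (↭-head-∈ q′)) fits′)
same-step p _ (joins _ _ q fits _) (opens none′) =
  ⊥-elim (All.lookup none′ (∈-resp-↭ p (↭-head-∈ q)) fits)
same-step p k≤k′ (joins _ _ q fits fullest) (joins _ _ q′ fits′ fullest′)
  with refl ← fullest-antisym (∈-resp-↭ p (↭-head-∈ q)) fits fullest′
                              (∈-resp-↭ (↭-sym p) (↭-head-∈ q′)) fits′ fullest =
  same (drop-∷ (↭-trans (↭-sym q) (↭-trans p q′))) (s≤s k≤k′)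

replaced-step : u ≤ v → O ↭ u ∷ T₀ → O′ ↭ v ∷ T₀ → k ℕ.≤ k′ → CoupledAfter O O′ k k′ y
replaced-step u≤v pu pv k≤k′ (opens _) (opens _) =
  replaced u≤v (↭-∷-under pu) (↭-∷-under pv) k≤k′
replaced-step u≤v pu pv _ (opens none) (joins _ _ q′ fits′ _)
  with ∈-resp-↭ pv (↭-head-∈ q′)
... | here refl = ⊥-elim (All.lookup none (↭-head-∈ pu) (Fits-antimonoˡ u≤v fits′))
... | there t′∈T = ⊥-elim (All.lookup none (↭-tail-⊆ pu t′∈T) fits′)
replaced-step {v = v} _ pu pv k≤k′ (joins _ _ q fits _) (opens none′)
  with ∈-resp-↭ pu (↭-head-∈ q)
... | here refl = extra (prep _ (↭-trans pv (prep v (drop-∷ (↭-trans (↭-sym pu) q))))) (s≤s k≤k′)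
... | there t∈T = ⊥-elim (All.lookup none′ (↭-tail-⊆ pv t∈T) fits)
replaced-step {v = v} u≤v pu pv k≤k′ (joins _ _ q fits fullest) (joins _ _ q′ fits′ fullest′)
  with ∷-↭-∷-inv (↭-trans (↭-sym pu) q) | ∷-↭-∷-inv (↭-trans (↭-sym pv) q′)
... | inj₁ (refl , T↭O₀) | inj₁ (refl , T↭O₀′) = same (↭-trans (↭-sym T↭O₀) T↭O₀′) (s≤s k≤k′)
... | inj₁ (refl , T↭O₀) | inj₂ (_ , T↭′ , O₀′↭) =
  replaced (ℚ.≤-trans (All.lookup fullest (↭-tail-⊆ pu (↭-head-∈ T↭′)) fits′) u≤v)
    (↭-trans (↭-sym T↭O₀) T↭′) O₀′↭ (s≤s k≤k′)
... | inj₂ (_ , T↭ , O₀↭) | inj₁ (refl , T↭O₀′) =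
  replaced (All.lookup fullest (↭-head-∈ pu) (Fits-antimonoˡ u≤v fits′))
    O₀↭ (↭-trans (↭-sym T↭O₀′) T↭) (s≤s k≤k′)
... | inj₂ (_ , T↭ , O₀↭) | inj₂ (_ , T↭′ , O₀′↭)
  with refl ← fullest-antisym (↭-tail-⊆ pv (↭-head-∈ T↭)) fits fullest′
                              (↭-tail-⊆ pu (↭-head-∈ T↭′)) fits′ fullest =
  replaced u≤v O₀↭ (↭-trans O₀′↭ (prep v (drop-∷ (↭-trans (↭-sym T↭′) T↭)))) (s≤s k≤k′)

extra-step : Incompatible a b → O′ ↭ a ∷ b ∷ O → k ℕ.≤ suc k′ → CoupledAfter O O′ k k′ y
extra-step {a} {b} _ pe k≤1+k′ (opens _) (opens _) =
  extra (↭-trans (↭-∷-under pe) (prep a (swap _ b ↭-refl))) k≤1+k′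
extra-step _ pe _ (joins _ _ q fits _) (opens none′) =
  ⊥-elim (All.lookup none′ (↭-tail-⊆ pe (there (↭-head-∈ q))) fits)
extra-step {a} {b} ab pe k≤1+k′ (opens none) (joins _ _ q′ fits′ _)
  with ∷-∷-↭-∷-inv (↭-trans (↭-sym pe) q′)
... | inj₁ (refl , O₀′↭) = replaced (Incompatible⇒≤ {a} ab fits′) ↭-refl O₀′↭ k≤1+k′
... | inj₂ (inj₁ (refl , O₀′↭)) =
  replaced (Incompatible⇒≤ {b} (Incompatible-sym {a} ab) fits′) ↭-refl O₀′↭ k≤1+k′
... | inj₂ (inj₂ (_ , O↭ , _)) = ⊥-elim (All.lookup none (↭-head-∈ O↭) fits′)
extra-step {a} {b} _ pe k≤1+k′ (joins _ _ q fits fullest) (joins _ _ q′ fits′ fullest′)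
  with ∷-∷-↭-∷-inv (↭-trans (↭-sym pe) q′)
... | inj₁ (refl , O₀′↭) = extra (↭-trans O₀′↭ (↭-∷-under q)) (s≤s k≤1+k′)
... | inj₂ (inj₁ (refl , O₀′↭)) = extra (↭-trans O₀′↭ (prep a q)) (s≤s k≤1+k′)
... | inj₂ (inj₂ (_ , O↭ , O₀′↭))
  with refl ← fullest-antisym (↭-tail-⊆ pe (there (↭-head-∈ q))) fits fullest′
                              (↭-head-∈ O↭) fits′ fullest =
  extra (↭-trans O₀′↭ (prep a (prep b (drop-∷ (↭-trans (↭-sym O↭) q))))) (s≤s k≤1+k′)

coupled-step : AllPairs Incompatible O′ → Coupled O O′ k k′ → CoupledAfter O O′ k k′ y
coupled-step _ (same p k≤k′) = same-step p k≤k′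
coupled-step _ (replaced u≤v pu pv k≤k′) = replaced-step u≤v pu pv k≤k′
coupled-step incompatible (extra pe k≤1+k′) =
  extra-step (All.head (AllPairs.head (AllPairs-Incompatible-resp-↭ pe incompatible))) pe k≤1+k′

coupled-start : y < y′ → (s : Placement O y) (s′ : Placement O y′) →
  Coupled (singlesAfter s) (singlesAfter s′) (closedAfter k s) (closedAfter k s′)
coupled-start y<y′ (opens _) (opens _) = replaced (ℚ.<⇒≤ y<y′) ↭-refl ↭-refl ℕ.≤-refl
coupled-start y<y′ (opens none) (joins t′ _ q′ fits′ _) =
  ⊥-elim (All.lookup none (↭-head-∈ q′) (Fits-antimonoʳ {t = t′} (ℚ.<⇒≤ y<y′) fits′))
coupled-start _ (joins _ _ q _ _) (opens _) = extra (prep _ q) ℕ.≤-refl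
coupled-start y<y′ (joins _ _ q _ fullest) (joins t′ _ q′ fits′ _)
  with ∷-↭-∷-inv (↭-trans (↭-sym q) q′)
... | inj₁ (refl , O₀↭O₀′) = same O₀↭O₀′ ℕ.≤-refl
... | inj₂ (_ , O₀↭ , O₀′↭) =
  replaced (All.lookup fullest (↭-head-∈ q′) (Fits-antimonoʳ {t = t′} (ℚ.<⇒≤ y<y′) fits′))
    O₀↭ O₀′↭ ℕ.≤-refl

data Related (B B′ : List ℚ) : Set where
  related : Decomposition B k O → Decomposition B′ k′ O′ → Coupled O O′ k k′ → Related B B′

Related⇒length-≤ : Related B B′ → length B ℕ.≤ length B′
Related⇒length-≤ (related d d′ c)
  rewrite decomposition-length d | decomposition-length d′ = coupled-length c

related-start : Decomposition B k O → Large y → y < y′ → Related (bfStep B y) (bfStep B y′)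
related-start d ly y<y′
  with s , e ← bfStep-decomposition d ly | s′ , e′ ← bfStep-decomposition d (ℚ.<-trans ly y<y′) =
  related e e′ (coupled-start y<y′ s s′)

related-foldl : Related B B′ → All Large ys → Related (foldl bfStep B ys) (foldl bfStep B′ ys)
related-foldl r [] = r
related-foldl (related d d′ c) (ly ∷ lys)
  with s , e ← bfStep-decomposition d ly | s′ , e′ ← bfStep-decomposition d′ ly =
  related-foldl (related e e′ (coupled-step (incompatible d′) c s s′)) lys

decomposition-foldl : Decomposition B k O → All Large ys → ∃₂ (Decomposition (foldl bfStep B ys))
decomposition-foldl d [] = _ , _ , d
decomposition-foldl d (ly ∷ lys) = decomposition-foldl (proj₂ (bfStep-decomposition d ly)) lys

BF-mono-item : All Large xs → Large y → y < y′ → All Large ys →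
  BF (xs ++ y ∷ ys) ℕ.≤ BF (xs ++ y′ ∷ ys)
BF-mono-item {xs} {y} {y′} {ys} lxs ly y<y′ lys
  rewrite List.foldl-++ bfStep [] xs (y ∷ ys) | List.foldl-++ bfStep [] xs (y′ ∷ ys)
  with _ , _ , d ← decomposition-foldl decomposition-[] lxs =
  Related⇒length-≤ (related-foldl (related-start d ly y<y′) lys)

tabulate-split : ∀ {A : Set} {n} (f g : Fin n → A) i → (∀ j → j ≢ i → g j ≡ f j) →
  ∃₂ λ xs ys → tabulate f ≡ xs ++ f i ∷ ys × tabulate g ≡ xs ++ g i ∷ ys
tabulate-split f g zero g≡f =
  [] , tabulate (f ∘ suc) , refl , cong (g zero ∷_) (List.tabulate-cong (λ j → g≡f (suc j) λ ()))
tabulate-split f g (suc i) g≡f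
  with xs , ys , f≡ , g≡ ← tabulate-split (f ∘ suc) (g ∘ suc) i
                             (λ j j≢i → g≡f (suc j) (j≢i ∘ Fin.suc-injective)) =
  f zero ∷ xs , ys , cong (f zero ∷_) f≡ , cong₂ _∷_ (g≡f zero λ ()) g≡

lemma17 : (n : ℕ) (x x′ : Fin n → ℚ) (i : Fin n)
    → (∀ k → oneThird < x k × x k ≤ 1ℚ)
    → (∀ k → 0ℚ < x′ k × x′ k ≤ 1ℚ)
    → x i < x′ i
    → (∀ j → j ≢ i → x′ j ≡ x j)
    → BF (toList x) Data.Nat.≤ BF (toList x′)
lemma17 n x x′ i x-bounds _ x<x′ x′≡x
  with xs , ys , x≡ , x′≡ ← tabulate-split x x′ i x′≡x
  with lxs , li ∷ lys ← All.++⁻ xs (subst (All Large) x≡ (All.tabulate⁺ (proj₁ ∘ x-bounds)))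
  rewrite x≡ | x′≡ = BF-mono-item lxs li x<x′ lys
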